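{- For every integer $k\ge2$ there exists $\varepsilon_0>0$ such that for every $0<\varepsilon\le\varepsilon_0$ there exists $n_0$ such that the following holds for all $n\ge n_0$. Let $H$ be a $(1-\varepsilon,\varepsilon)$-dense $k$-graph on $n$ vertices and let $W\subseteq V(H)$ with $|W|>2\varepsilon n$. Let $e_1,e_2$ be edges of $H[W]$. Then there exists a tight pseudo-walk of length $2k$ from $e_1$ to $e_2$ in $H[W]$.
   Context: A $k$-graph $H$ is a pair $(V(H),E(H))$ with $E(H)\subseteq\binom{V(H)}{k}$. For $W\subseteq V(H)$, $H[W]$ is the $k$-graph on $W$ whose edges are the edges of $H$ contained in $W$. For $S\subseteq V(H)$ with $|S|\le k-1$, $N_H(S)=\{S'\in\binom{V(H)}{k-|S|}: S\cup S'\in E(H)\}$ and $d_H(S)=|N_H(S)|$. A $k$-graph $H$ on $n$ vertices is $(\mu,\alpha)$-dense if for each $i\in[k-1]$ we have $d_H(S)\ge\mu\binom{n}{k-i}$ for all but at most $\alpha\binom{n}{i}$ sets $S\in\binom{V(H)}{i}$, and $d_H(S)=0$ for all other sets $S\in\binom{V(H)}{i}$. A tight pseudo-walk of length $m$ from $e$ to $e'$ is a sequence of edges $f_1\dots f_m$ with $|f_i\cap f_{i+1}|\ge k-1$ for all $i\in[m-1]$ and $(f_1,f_m)=(e,e')$.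
   Formalization: The parameter ε in $0<\varepsilon\le\varepsilon_0$ ranges only over the rationals. -}

module Defs where

open import Data.Bool using (Bool; true; false; T)
open import Data.Nat as ℕ using (ℕ; zero; suc; _∸_)
open import Data.Nat.Combinatorics using (_C_)
open import Data.Integer using (+_)
open import Data.Rational using (ℚ; _/_; _*_; _≤_; _<_)
open import Data.Rational.Properties using (_≤?_)
open import Data.List using (List; []; _∷_; map; _++_; filter; length)
open import Data.Fin.Subset using (Subset; _∩_; _∪_; _⊆_; ∣_∣)
open import Data.Vec using (_∷_; [])
open import Data.Product using (Σ; _×_; _,_)
open import Data.Sum using (_⊎_)
open import Relation.Nullary using (¬_)
open import Relation.Nullary.Decidable using (¬?)
open import Relation.Binary.PropositionalEquality using (_≡_)

ℕtoℚ : ℕ → ℚ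
ℕtoℚ m = (+ m) / 1

allSubsets : (n : ℕ) → List (Subset n)
allSubsets zero    = [] ∷ []
allSubsets (suc n) = map (true ∷_) (allSubsets n) ++ map (false ∷_) (allSubsets n)

subsetsOfSize : (n j : ℕ) → List (Subset n)
subsetsOfSize n j = filter (λ S → ∣ S ∣ ℕ.≟ j) (allSubsets n)

record KGraph (k n : ℕ) : Set where
  field
    isEdge   : Subset n → Bool
    edgeSize : ∀ e → T (isEdge e) → ∣ e ∣ ≡ k
open KGraph public

degree : ∀ {k n} → KGraph k n → Subset n → ℕ
degree {k} {n} H S =
  length (filter (λ S' → Data.Bool._≟_ (isEdge H (S ∪ S')) true)
                 (subsetsOfSize n (k ∸ ∣ S ∣)))
  where import Data.Bool

HighDeg : ∀ {k n} → KGraph k n → ℚ → ℕ → Subset n → Set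
HighDeg {k} {n} H μ i S = μ * ℕtoℚ (n C (k ∸ i)) ≤ ℕtoℚ (degree H S)

Dense : ∀ {k n} → ℚ → ℚ → KGraph k n → Set
Dense {k} {n} μ α H =
  ∀ i → 1 ℕ.≤ i → i ℕ.≤ k ∸ 1 →
    (ℕtoℚ (length (filter (λ S → ¬? (μ * ℕtoℚ (n C (k ∸ i)) ≤? ℕtoℚ (degree H S)))
                          (subsetsOfSize n i)))
       ≤ α * ℕtoℚ (n C i))
    × (∀ S → ∣ S ∣ ≡ i → HighDeg H μ i S ⊎ degree H S ≡ 0)

IsEdgeIn : ∀ {k n} → KGraph k n → Subset n → Subset n → Set
IsEdgeIn H W e = T (isEdge H e) × e ⊆ W

-- tight pseudo-walk f_1 … f_m (indexed f 0 … f (m-1)) from e to e' in H[W]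
TightPseudoWalk : ∀ {k n} → KGraph k n → Subset n → ℕ → Subset n → Subset n → Set
TightPseudoWalk {k} {n} H W m e e' =
  Σ (ℕ → Subset n) λ f →
    (∀ i → i ℕ.< m → IsEdgeIn H W (f i))
    × (∀ i → suc i ℕ.< m → k ∸ 1 ℕ.≤ ∣ f i ∩ f (suc i) ∣)
    × (f 0 ≡ e)
    × (f (m ∸ 1) ≡ e')

{-# OPTIONS --safe #-}
module Submission where

-- Two edges A, B of H[W] are walked towards each other, gaining one common vertex per step.
-- While |A ∩ B| < k - 1, extend A ∩ B to (k-1)-sets S ⊆ A and S′ ⊆ B. Both lie in edges, so
-- by density their codegrees are at least (1 - ε)n; with |W| > 2εn the three vertex sets W,
-- N(S), N(S′) have total size above 2n, hence share a vertex v. Then S ∪ {v} and S′ ∪ {v} are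
-- edges of H[W], tightly adjacent to A and B respectively, meeting in (A ∩ B) ∪ {v}. After
-- k - 1 steps (repeating an edge once A and B are already adjacent) the two halves join into a
-- tight pseudo-walk with 2k edges. Nothing requires ε small or n large: ε₀ = 1 and n₀ = 0.

open import Defs using (KGraph)
open import Data.Fin.Subset using (Subset)

module RationalArithmetic where

  open import Defs using (ℕtoℚ)
  import Data.Nat as ℕ
  import Data.Nat.Properties as ℕ
  open import Data.Nat.Coprimality using (1-coprimeTo)
  import Data.Nat.Coprimality as Coprime
  open import Data.Integer as ℤ using (+_; +≤+)
  import Data.Integer.Properties as ℤ
  open import Data.Rational
  open import Data.Rational.Properties
  open import Data.Rational.Solver using (module +-*-Solver)
  open import Relation.Nullary using (yes; no; contradiction)
  open import Relation.Binary.PropositionalEquality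

  ℕtoℚ≡mkℚ : ∀ m → ℕtoℚ m ≡ mkℚ (+ m) 0 (Coprime.sym (1-coprimeTo m))
  ℕtoℚ≡mkℚ m = normalize-coprime (Coprime.sym (1-coprimeTo m))

  ℕtoℚ-homo-+ : ∀ m n → ℕtoℚ (m ℕ.+ n) ≡ ℕtoℚ m + ℕtoℚ n
  ℕtoℚ-homo-+ m n
    rewrite ℕtoℚ≡mkℚ m | ℕtoℚ≡mkℚ n | ℤ.*-identityʳ (+ m) | ℤ.*-identityʳ (+ n) = refl

  ℕtoℚ-mono-≤ : ∀ {m n} → m ℕ.≤ n → ℕtoℚ m ≤ ℕtoℚ n
  ℕtoℚ-mono-≤ {m} {n} m≤n rewrite ℕtoℚ≡mkℚ m | ℕtoℚ≡mkℚ n =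
    *≤* (subst₂ ℤ._≤_ (sym (ℤ.*-identityʳ (+ m))) (sym (ℤ.*-identityʳ (+ n))) (+≤+ m≤n))

  ℕtoℚ-cancel-< : ∀ {m n} → ℕtoℚ m < ℕtoℚ n → m ℕ.< n
  ℕtoℚ-cancel-< {m} {n} lt with m ℕ.<? n
  ... | yes m<n = m<n
  ... | no  m≮n = contradiction (<-≤-trans lt (ℕtoℚ-mono-≤ (ℕ.≮⇒≥ m≮n))) (<-irrefl refl)

  covering-bound : ∀ ε N w d₁ d₂ → ℕtoℚ 2 * (ε * N) < w →
                   (1ℚ - ε) * N ≤ d₁ → (1ℚ - ε) * N ≤ d₂ → N + N < w + (d₁ + d₂)
  covering-bound ε N w d₁ d₂ large d₁-large d₂-large =
    subst (_< w + (d₁ + d₂)) (shares-sum ε N) (+-mono-<-≤ large (+-mono-≤ d₁-large d₂-large))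
    where
    open +-*-Solver
    shares-sum : ∀ ε N → ℕtoℚ 2 * (ε * N) + ((1ℚ - ε) * N + (1ℚ - ε) * N) ≡ N + N
    shares-sum = solve 2 (λ ε N → con (ℕtoℚ 2) :* (ε :* N) :+ ((con 1ℚ :- ε) :* N :+ (con 1ℚ :- ε) :* N)
                                  := N :+ N) refl

module FilterCounting where

  open import Level using (Level)
  open import Data.Bool using (true; false)
  open import Data.Nat using (ℕ; _+_; _≤_; _<_; s≤s)
  open import Data.Nat.Properties
  open import Data.List using ([]; _∷_; map; filter; length)
  open import Data.List.Relation.Unary.Any using (here)
  open import Data.List.Membership.Propositional using (_∈_)
  open import Data.List.Membership.Propositional.Properties using (∈-filter⁻)
  open import Data.Product using (∃-syntax; _×_; _,_)
  open import Relation.Nullary using (does; yes; no)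
  open import Relation.Unary using (Pred; Decidable)
  open import Relation.Unary.Properties using (_∩?_)
  open import Relation.Binary.PropositionalEquality
  open import Algebra.Properties.CommutativeSemigroup +-commutativeSemigroup using (x∙yz≈y∙xz)

  private
    variable
      a b p q r : Level
      A B : Set a

  filter-map : ∀ {P : Pred B p} {Q : Pred A q} (P? : Decidable P) (Q? : Decidable Q) (f : A → B) →
               (∀ x → does (P? (f x)) ≡ does (Q? x)) →
               ∀ xs → filter P? (map f xs) ≡ map f (filter Q? xs)
  filter-map P? Q? f same []       = refl
  filter-map P? Q? f same (x ∷ xs) rewrite same x with does (Q? x)
  ... | true  = cong (f x ∷_) (filter-map P? Q? f same xs)
  ... | false = filter-map P? Q? f same xs

  ∃-∈-filter : ∀ {P : Pred A p} (P? : Decidable P) {xs} → 0 < length (filter P? xs) →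
               ∃[ x ] x ∈ xs × P x
  ∃-∈-filter P? {xs} nonempty with filter P? xs in eq
  ... | y ∷ _ = y , ∈-filter⁻ P? (subst (y ∈_) (sym eq) (here refl))

  module _ {P : Pred A p} {Q : Pred A q} (P? : Decidable P) (Q? : Decidable Q) where

    length-filter-∩ : ∀ xs → length (filter P? xs) + length (filter Q? xs) ≤
                             length xs + length (filter (P? ∩? Q?) xs)
    length-filter-∩ []       = ≤-refl
    length-filter-∩ (x ∷ xs) with P? x | Q? x | length-filter-∩ xs
    ... | yes _ | yes _ | ih =
      s≤s (≤-trans (≤-reflexive (+-suc _ _)) (≤-trans (s≤s ih) (≤-reflexive (sym (+-suc _ _)))))
    ... | yes _ | no  _ | ih = s≤s ih
    ... | no  _ | yes _ | ih = ≤-trans (≤-reflexive (+-suc _ _)) (s≤s ih)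
    ... | no  _ | no  _ | ih = m≤n⇒m≤1+n ih

  module _ {P : Pred A p} {Q : Pred A q} {R : Pred A r}
           (P? : Decidable P) (Q? : Decidable Q) (R? : Decidable R) where

    ∃-common : ∀ xs → length xs + length xs <
                      length (filter P? xs) + (length (filter Q? xs) + length (filter R? xs)) →
               ∃[ x ] x ∈ xs × P x × Q x × R x
    ∃-common xs crowded = ∃-∈-filter (P? ∩? (Q? ∩? R?)) (+-cancelˡ-< (n + n) 0 _ (begin-strict
      (n + n) + 0
        ≡⟨ +-identityʳ (n + n) ⟩
      n + n
        <⟨ crowded ⟩
      cP + (length (filter Q? xs) + length (filter R? xs))
        ≤⟨ +-monoʳ-≤ cP (length-filter-∩ Q? R? xs) ⟩
      cP + (n + length (filter (Q? ∩? R?) xs))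
        ≡⟨ x∙yz≈y∙xz cP n _ ⟩
      n + (cP + length (filter (Q? ∩? R?) xs))
        ≤⟨ +-monoʳ-≤ n (length-filter-∩ P? (Q? ∩? R?) xs) ⟩
      n + (n + length (filter (P? ∩? (Q? ∩? R?)) xs))
        ≡⟨ +-assoc n n _ ⟨
      (n + n) + length (filter (P? ∩? (Q? ∩? R?)) xs) ∎))
      where
      open ≤-Reasoning
      n cP : ℕ
      n = length xs
      cP = length (filter P? xs)

module SubsetProperties where

  open import Data.Bool using (true; false)
  open import Data.Nat using (ℕ; zero; suc; _+_; _≤_; z≤n; s≤s)
  open import Data.Nat.Properties
  open import Data.Vec using ([]; _∷_; here)
  open import Data.Fin.Subset
  open import Data.Fin.Subset.Properties
  open import Data.Product using (∃-syntax; _×_; _,_)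
  open import Data.Sum using (inj₁; inj₂)
  open import Relation.Nullary using (yes; no; contradiction)
  open import Relation.Binary.PropositionalEquality

  private
    variable
      n : ℕ
      p q r : Subset n

  ∣p∪q∣+∣p∩q∣≡∣p∣+∣q∣ : ∀ (p q : Subset n) → ∣ p ∪ q ∣ + ∣ p ∩ q ∣ ≡ ∣ p ∣ + ∣ q ∣
  ∣p∪q∣+∣p∩q∣≡∣p∣+∣q∣ []            []            = refl
  ∣p∪q∣+∣p∩q∣≡∣p∣+∣q∣ (true  ∷ p) (true  ∷ q) =
    cong suc (trans (+-suc _ _) (trans (cong suc (∣p∪q∣+∣p∩q∣≡∣p∣+∣q∣ p q)) (sym (+-suc _ _))))
  ∣p∪q∣+∣p∩q∣≡∣p∣+∣q∣ (true  ∷ p) (false ∷ q) = cong suc (∣p∪q∣+∣p∩q∣≡∣p∣+∣q∣ p q)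
  ∣p∪q∣+∣p∩q∣≡∣p∣+∣q∣ (false ∷ p) (true  ∷ q) =
    trans (cong suc (∣p∪q∣+∣p∩q∣≡∣p∣+∣q∣ p q)) (sym (+-suc _ _))
  ∣p∪q∣+∣p∩q∣≡∣p∣+∣q∣ (false ∷ p) (false ∷ q) = ∣p∪q∣+∣p∩q∣≡∣p∣+∣q∣ p q

  p⊆r∧q⊆r⇒p∪q⊆r : p ⊆ r → q ⊆ r → p ∪ q ⊆ r
  p⊆r∧q⊆r⇒p∪q⊆r {p = p} {q = q} p⊆r q⊆r x∈p∪q with x∈p∪q⁻ p q x∈p∪q
  ... | inj₁ x∈p = p⊆r x∈p
  ... | inj₂ x∈q = q⊆r x∈q

  r⊆p∧r⊆q⇒r⊆p∩q : r ⊆ p → r ⊆ q → r ⊆ p ∩ q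
  r⊆p∧r⊆q⇒r⊆p∩q r⊆p r⊆q x∈r = x∈p∩q⁺ (r⊆p x∈r , r⊆q x∈r)

  p⊆q⇒p∪[q─p]≡q : p ⊆ q → p ∪ (q ─ p) ≡ q
  p⊆q⇒p∪[q─p]≡q {p = []}        {q = []}        _   = refl
  p⊆q⇒p∪[q─p]≡q {p = true  ∷ p} {q = false ∷ q} p⊆q with () ← p⊆q here
  p⊆q⇒p∪[q─p]≡q {p = true  ∷ p} {q = true  ∷ q} p⊆q = cong (true ∷_) (p⊆q⇒p∪[q─p]≡q (drop-∷-⊆ p⊆q))
  p⊆q⇒p∪[q─p]≡q {p = false ∷ p} {q = true  ∷ q} p⊆q = cong (true ∷_) (p⊆q⇒p∪[q─p]≡q (drop-∷-⊆ p⊆q))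
  p⊆q⇒p∪[q─p]≡q {p = false ∷ p} {q = false ∷ q} p⊆q = cong (false ∷_) (p⊆q⇒p∪[q─p]≡q (drop-∷-⊆ p⊆q))

  p⊆q⇒∣p∣+∣q─p∣≡∣q∣ : p ⊆ q → ∣ p ∣ + ∣ q ─ p ∣ ≡ ∣ q ∣
  p⊆q⇒∣p∣+∣q─p∣≡∣q∣ {p = []}        {q = []}        _   = refl
  p⊆q⇒∣p∣+∣q─p∣≡∣q∣ {p = true  ∷ p} {q = false ∷ q} p⊆q with () ← p⊆q here
  p⊆q⇒∣p∣+∣q─p∣≡∣q∣ {p = true  ∷ p} {q = true  ∷ q} p⊆q = cong suc (p⊆q⇒∣p∣+∣q─p∣≡∣q∣ (drop-∷-⊆ p⊆q))
  p⊆q⇒∣p∣+∣q─p∣≡∣q∣ {p = false ∷ p} {q = true  ∷ q} p⊆q =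
    trans (+-suc _ _) (cong suc (p⊆q⇒∣p∣+∣q─p∣≡∣q∣ (drop-∷-⊆ p⊆q)))
  p⊆q⇒∣p∣+∣q─p∣≡∣q∣ {p = false ∷ p} {q = false ∷ q} p⊆q = p⊆q⇒∣p∣+∣q─p∣≡∣q∣ (drop-∷-⊆ p⊆q)

  ⊆-interpolate : ∀ m → p ⊆ q → ∣ p ∣ ≤ m → m ≤ ∣ q ∣ → ∃[ r ] p ⊆ r × r ⊆ q × ∣ r ∣ ≡ m
  ⊆-interpolate {p = []} {q = []} m _ _ m≤0 = [] , (λ ()) , (λ ()) , sym (n≤0⇒n≡0 m≤0)
  ⊆-interpolate {p = true ∷ p} {q = false ∷ q} m p⊆q with () ← p⊆q here
  ⊆-interpolate {p = true ∷ p} {q = true ∷ q} (suc m) p⊆q (s≤s ∣p∣≤m) (s≤s m≤∣q∣)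
    with r , p⊆r , r⊆q , ∣r∣≡m ← ⊆-interpolate m (drop-∷-⊆ p⊆q) ∣p∣≤m m≤∣q∣ =
    true ∷ r , in⊆in p⊆r , in⊆in r⊆q , cong suc ∣r∣≡m
  ⊆-interpolate {p = false ∷ p} {q = false ∷ q} m p⊆q ∣p∣≤m m≤∣q∣
    with r , p⊆r , r⊆q , ∣r∣≡m ← ⊆-interpolate m (drop-∷-⊆ p⊆q) ∣p∣≤m m≤∣q∣ =
    false ∷ r , s⊆s p⊆r , s⊆s r⊆q , ∣r∣≡m
  ⊆-interpolate {p = false ∷ p} {q = true ∷ q} m p⊆q ∣p∣≤m m≤1+∣q∣ with m ≤? ∣ q ∣
  ... | yes m≤∣q∣ with r , p⊆r , r⊆q , ∣r∣≡m ← ⊆-interpolate m (drop-∷-⊆ p⊆q) ∣p∣≤m m≤∣q∣ =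
    false ∷ r , s⊆s p⊆r , out⊆ r⊆q , ∣r∣≡m
  ⊆-interpolate {p = false ∷ p} {q = true ∷ q} zero    p⊆q _ _ | no 0≰∣q∣ = contradiction z≤n 0≰∣q∣
  ⊆-interpolate {p = false ∷ p} {q = true ∷ q} (suc m) p⊆q _ (s≤s m≤∣q∣) | no 1+m≰∣q∣
    with r , p⊆r , r⊆q , ∣r∣≡m ←
         ⊆-interpolate m (drop-∷-⊆ p⊆q) (≤-trans (p⊆q⇒∣p∣≤∣q∣ (drop-∷-⊆ p⊆q)) (≮⇒≥ 1+m≰∣q∣)) m≤∣q∣ =
    true ∷ r , out⊆ p⊆r , in⊆in r⊆q , cong suc ∣r∣≡m

  extension-grows : ∀ {x s t d : Subset n} → x ⊆ s → x ⊆ t → ∣ s ∩ d ∣ ≡ 0 →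
                    ∣ x ∣ + ∣ d ∣ ≤ ∣ (s ∪ d) ∩ (t ∪ d) ∣
  extension-grows {x = x} {s} {t} {d} x⊆s x⊆t s∩d≡0 = begin
    ∣ x ∣ + ∣ d ∣                ≡⟨ ∣p∪q∣+∣p∩q∣≡∣p∣+∣q∣ x d ⟨
    ∣ x ∪ d ∣ + ∣ x ∩ d ∣        ≡⟨ cong (∣ x ∪ d ∣ +_) x∩d≡0 ⟩
    ∣ x ∪ d ∣ + 0                ≡⟨ +-identityʳ _ ⟩
    ∣ x ∪ d ∣                    ≤⟨ p⊆q⇒∣p∣≤∣q∣ (p⊆r∧q⊆r⇒p∪q⊆r x⊆both d⊆both) ⟩
    ∣ (s ∪ d) ∩ (t ∪ d) ∣        ∎
    where
    open ≤-Reasoning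
    x∩d≡0 : ∣ x ∩ d ∣ ≡ 0
    x∩d≡0 = n≤0⇒n≡0 (≤-trans (p⊆q⇒∣p∣≤∣q∣ (r⊆p∧r⊆q⇒r⊆p∩q (⊆-trans (p∩q⊆p x d) x⊆s) (p∩q⊆q x d)))
                              (≤-reflexive s∩d≡0))
    x⊆both : x ⊆ (s ∪ d) ∩ (t ∪ d)
    x⊆both = r⊆p∧r⊆q⇒r⊆p∩q (⊆-trans x⊆s (p⊆p∪q d)) (⊆-trans x⊆t (p⊆p∪q d))
    d⊆both : d ⊆ (s ∪ d) ∩ (t ∪ d)
    d⊆both = r⊆p∧r⊆q⇒r⊆p∩q (q⊆p∪q s d) (q⊆p∪q t d)

module SubsetsOfSize where

  open import Defs using (allSubsets; subsetsOfSize)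
  open import Data.Bool using (true; false)
  open import Data.Nat as ℕ using (ℕ; zero; suc)
  open import Data.List using (List; []; _∷_; map; _++_; filter; length)
  open import Data.List.Properties using (filter-++; filter-none; filter-accept; length-map)
  import Data.List.Relation.Unary.All as All
  import Data.List.Relation.Unary.All.Properties as All
  open import Data.List.Relation.Unary.Any using (here)
  open import Data.List.Membership.Propositional using (_∈_)
  open import Data.List.Membership.Propositional.Properties using (∈-map⁺; ∈-++⁺ˡ; ∈-++⁺ʳ; ∈-filter⁺; ∈-filter⁻)
  open import Data.Vec using ([]; _∷_)
  open import Data.Fin.Subset using (Subset; inside; outside; ⊥; _⊆_; ∣_∣)
  open import Data.Fin.Subset.Properties using (_⊆?_; in⊆in; ⊆-min)
  open import Data.Product using (proj₂)
  open import Relation.Nullary using (Dec)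
  open import Relation.Binary.PropositionalEquality
  open FilterCounting using (filter-map)

  size≟ : ∀ j {n} (p : Subset n) → Dec (∣ p ∣ ≡ j)
  size≟ j p = ∣ p ∣ ℕ.≟ j

  ∈-allSubsets : ∀ {n} (p : Subset n) → p ∈ allSubsets n
  ∈-allSubsets []          = here refl
  ∈-allSubsets (true  ∷ p) = ∈-++⁺ˡ (∈-map⁺ (true ∷_) (∈-allSubsets p))
  ∈-allSubsets (false ∷ p) = ∈-++⁺ʳ (map (true ∷_) (allSubsets _)) (∈-map⁺ (false ∷_) (∈-allSubsets p))

  ∈-subsetsOfSize⁺ : ∀ {n j} {p : Subset n} → ∣ p ∣ ≡ j → p ∈ subsetsOfSize n j
  ∈-subsetsOfSize⁺ {j = j} {p} ∣p∣≡j = ∈-filter⁺ (size≟ j) (∈-allSubsets p) ∣p∣≡j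

  ∈-subsetsOfSize⁻ : ∀ {n j} {p : Subset n} → p ∈ subsetsOfSize n j → ∣ p ∣ ≡ j
  ∈-subsetsOfSize⁻ {n} {j} p∈ = proj₂ (∈-filter⁻ (size≟ j) {xs = allSubsets n} p∈)

  singletons : ∀ n → List (Subset n)
  singletons zero    = []
  singletons (suc n) = (inside ∷ ⊥) ∷ map (outside ∷_) (singletons n)

  subsetsOfSize-0 : ∀ n → subsetsOfSize n 0 ≡ ⊥ ∷ []
  subsetsOfSize-0 zero    = refl
  subsetsOfSize-0 (suc n) = begin
    filter (size≟ 0) (map (inside ∷_) (allSubsets n) ++ map (outside ∷_) (allSubsets n))
      ≡⟨ filter-++ (size≟ 0) (map (inside ∷_) (allSubsets n)) _ ⟩
    filter (size≟ 0) (map (inside ∷_) (allSubsets n)) ++ filter (size≟ 0) (map (outside ∷_) (allSubsets n))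
      ≡⟨ cong₂ _++_ (filter-none (size≟ 0) (All.map⁺ (All.universal (λ _ ()) (allSubsets n))))
                    (filter-map (size≟ 0) (size≟ 0) (outside ∷_) (λ _ → refl) (allSubsets n)) ⟩
    map (outside ∷_) (subsetsOfSize n 0)
      ≡⟨ cong (map (outside ∷_)) (subsetsOfSize-0 n) ⟩
    ⊥ ∷ [] ∎
    where open ≡-Reasoning

  subsetsOfSize-1 : ∀ n → subsetsOfSize n 1 ≡ singletons n
  subsetsOfSize-1 zero    = refl
  subsetsOfSize-1 (suc n) = begin
    filter (size≟ 1) (map (inside ∷_) (allSubsets n) ++ map (outside ∷_) (allSubsets n))
      ≡⟨ filter-++ (size≟ 1) (map (inside ∷_) (allSubsets n)) _ ⟩
    filter (size≟ 1) (map (inside ∷_) (allSubsets n)) ++ filter (size≟ 1) (map (outside ∷_) (allSubsets n))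
      ≡⟨ cong₂ _++_ (filter-map (size≟ 1) (size≟ 0) (inside ∷_) (λ _ → refl) (allSubsets n))
                    (filter-map (size≟ 1) (size≟ 1) (outside ∷_) (λ _ → refl) (allSubsets n)) ⟩
    map (inside ∷_) (subsetsOfSize n 0) ++ map (outside ∷_) (subsetsOfSize n 1)
      ≡⟨ cong₂ (λ zeros ones → map (inside ∷_) zeros ++ map (outside ∷_) ones)
               (subsetsOfSize-0 n) (subsetsOfSize-1 n) ⟩
    singletons (suc n) ∎
    where open ≡-Reasoning

  length-singletons : ∀ n → length (singletons n) ≡ n
  length-singletons zero    = refl
  length-singletons (suc n) = cong suc (trans (length-map (outside ∷_) (singletons n)) (length-singletons n))

  length-filter-⊆-singletons : ∀ {n} (W : Subset n) → length (filter (_⊆? W) (singletons n)) ≡ ∣ W ∣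
  length-filter-⊆-outsides : ∀ {n} b (W : Subset n) →
                             length (filter (_⊆? (b ∷ W)) (map (outside ∷_) (singletons n))) ≡ ∣ W ∣

  length-filter-⊆-singletons []          = refl
  length-filter-⊆-singletons (true  ∷ W) =
    trans (cong length (filter-accept (_⊆? (true ∷ W)) (in⊆in (⊆-min W))))
          (cong suc (length-filter-⊆-outsides true W))
  length-filter-⊆-singletons (false ∷ W) = length-filter-⊆-outsides false W

  length-filter-⊆-outsides {n} b W = begin
    length (filter (_⊆? (b ∷ W)) (map (outside ∷_) (singletons n)))
      ≡⟨ cong length (filter-map (_⊆? (b ∷ W)) (_⊆? W) (outside ∷_) (λ _ → refl) (singletons n)) ⟩
    length (map (outside ∷_) (filter (_⊆? W) (singletons n)))
      ≡⟨ length-map (outside ∷_) (filter (_⊆? W) (singletons n)) ⟩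
    length (filter (_⊆? W) (singletons n))
      ≡⟨ length-filter-⊆-singletons W ⟩
    ∣ W ∣ ∎
    where open ≡-Reasoning

  length-subsetsOfSize-1 : ∀ n → length (subsetsOfSize n 1) ≡ n
  length-subsetsOfSize-1 n = trans (cong length (subsetsOfSize-1 n)) (length-singletons n)

  length-filter-⊆-subsetsOfSize-1 : ∀ {n} (W : Subset n) → length (filter (_⊆? W) (subsetsOfSize n 1)) ≡ ∣ W ∣
  length-filter-⊆-subsetsOfSize-1 {n} W =
    trans (cong (λ L → length (filter (_⊆? W) L)) (subsetsOfSize-1 n)) (length-filter-⊆-singletons W)

module Codegrees where

  open import Defs
  open import Data.Bool as Bool using (T; true)
  open import Data.Bool.Properties using (T-≡)
  open import Data.Nat using (suc; _+_; _∸_; _≤_; _<_)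
  open import Data.Nat.Properties
  open import Data.Nat.Combinatorics using (_C_; nC1≡n)
  open import Data.List using (filter; length)
  open import Data.List.Properties using (filter-some)
  open import Data.List.Membership.Propositional using (lose)
  open import Data.Fin.Subset using (Subset; _∪_; _∩_; _─_; _⊆_; ∣_∣)
  open import Data.Rational using () renaming (_*_ to _*ℚ_; _≤_ to _≤ℚ_)
  open import Data.Product using (proj₂)
  open import Data.Sum using ([_,_]′)
  open import Function.Bundles using (Equivalence)
  open import Relation.Nullary using (Dec; contradiction)
  open import Relation.Binary.PropositionalEquality
  open SubsetProperties
  open SubsetsOfSize

  module _ {k n} (H : KGraph k n) where

    extends? : (S D : Subset n) → Dec (isEdge H (S ∪ D) ≡ true)
    extends? S D = isEdge H (S ∪ D) Bool.≟ true

    edge-split-disjoint : ∀ {S D} → T (isEdge H (S ∪ D)) → ∣ S ∣ + ∣ D ∣ ≡ k → ∣ S ∩ D ∣ ≡ 0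
    edge-split-disjoint {S} {D} e sizes = +-cancelˡ-≡ k _ _ (begin
      k + ∣ S ∩ D ∣           ≡⟨ cong (_+ ∣ S ∩ D ∣) (edgeSize H (S ∪ D) e) ⟨
      ∣ S ∪ D ∣ + ∣ S ∩ D ∣   ≡⟨ ∣p∪q∣+∣p∩q∣≡∣p∣+∣q∣ S D ⟩
      ∣ S ∣ + ∣ D ∣           ≡⟨ sizes ⟩
      k                       ≡⟨ +-identityʳ k ⟨
      k + 0                   ∎)
      where open ≡-Reasoning

  module _ {K n} (H : KGraph (suc K) n) where

    degree-codim1 : ∀ {S} → ∣ S ∣ ≡ K → degree H S ≡ length (filter (extends? H S) (subsetsOfSize n 1))
    degree-codim1 {S} ∣S∣≡K =
      cong (λ j → length (filter (extends? H S) (subsetsOfSize n j)))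
           (trans (cong (suc K ∸_) ∣S∣≡K) (m+n∸n≡m 1 K))

    degree-pos : ∀ {A S} → T (isEdge H A) → S ⊆ A → ∣ S ∣ ≡ K → 0 < degree H S
    degree-pos {A} {S} eA S⊆A ∣S∣≡K = subst (0 <_) (sym (degree-codim1 ∣S∣≡K))
      (filter-some (extends? H S) (lose (∈-subsetsOfSize⁺ ∣A─S∣≡1) completes))
      where
      completes : isEdge H (S ∪ (A ─ S)) ≡ true
      completes = trans (cong (isEdge H) (p⊆q⇒p∪[q─p]≡q S⊆A)) (Equivalence.to T-≡ eA)
      ∣A─S∣≡1 : ∣ A ─ S ∣ ≡ 1
      ∣A─S∣≡1 = +-cancelˡ-≡ K _ _ (begin
        K + ∣ A ─ S ∣      ≡⟨ cong (_+ ∣ A ─ S ∣) ∣S∣≡K ⟨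
        ∣ S ∣ + ∣ A ─ S ∣  ≡⟨ p⊆q⇒∣p∣+∣q─p∣≡∣q∣ S⊆A ⟩
        ∣ A ∣              ≡⟨ edgeSize H A eA ⟩
        suc K              ≡⟨ +-comm 1 K ⟩
        K + 1              ∎)
        where open ≡-Reasoning

    K≤∣edge∣ : ∀ {E} → T (isEdge H E) → K ≤ ∣ E ∣
    K≤∣edge∣ {E} eE = ≤-trans (n≤1+n K) (≤-reflexive (sym (edgeSize H E eE)))

    Dense⇒high-codegree : ∀ {μ α A S} → 1 ≤ K → Dense μ α H → T (isEdge H A) → S ⊆ A → ∣ S ∣ ≡ K →
                          μ *ℚ ℕtoℚ n ≤ℚ ℕtoℚ (degree H S)
    Dense⇒high-codegree {μ} {S = S} 1≤K dense eA S⊆A ∣S∣≡K =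
      [ subst (λ m → μ *ℚ ℕtoℚ m ≤ℚ ℕtoℚ (degree H S)) (trans (cong (n C_) (m+n∸n≡m 1 K)) (nC1≡n n))
      , (λ d≡0 → contradiction d≡0 (>⇒≢ (degree-pos eA S⊆A ∣S∣≡K))) ]′ (proj₂ (dense K 1≤K ≤-refl) S ∣S∣≡K)

module Walks {k n} (H : KGraph k n) (W : Subset n) where

  open import Defs
  open import Data.Nat using (ℕ; zero; suc; _+_; _*_; _∸_; _≤_; _<_; _<?_; s≤s)
  open import Data.Nat.Properties
  open import Data.Fin.Subset using (Subset; _∩_; _⊆_; ∣_∣)
  open import Data.Fin.Subset.Properties using (∩-idem; p⊆q⇒∣p∣≤∣q∣)
  open SubsetProperties using (r⊆p∧r⊆q⇒r⊆p∩q)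
  open import Data.Product using (∃₂; _×_; _,_)
  open import Relation.Nullary using (yes; no)
  open import Relation.Binary.PropositionalEquality

  Edge : Subset n → Set
  Edge = IsEdgeIn H W

  Adjacent : Subset n → Subset n → Set
  Adjacent A B = k ∸ 1 ≤ ∣ A ∩ B ∣

  adjacent-refl : ∀ {A} → Edge A → Adjacent A A
  adjacent-refl {A} (eA , _) =
    ≤-trans (m∸n≤m k 1) (≤-reflexive (trans (sym (edgeSize H A eA)) (cong ∣_∣ (sym (∩-idem A)))))

  infixr 5 _∷⟨_⟩_
  infixl 5 _∷ʳ⟨_⟩_

  data Walk : ℕ → Subset n → Subset n → Set where
    [_]     : ∀ {A} → Edge A → Walk 0 A A
    _∷⟨_⟩_ : ∀ {ℓ A B C} → Edge A → Adjacent A B → Walk ℓ B C → Walk (suc ℓ) A C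

  _∷ʳ⟨_⟩_ : ∀ {ℓ A B C} → Walk ℓ A B → Adjacent B C → Edge C → Walk (suc ℓ) A C
  [ eA ]           ∷ʳ⟨ BC ⟩ eC = eA ∷⟨ BC ⟩ [ eC ]
  (eA ∷⟨ AB ⟩ w) ∷ʳ⟨ BC ⟩ eC = eA ∷⟨ AB ⟩ (w ∷ʳ⟨ BC ⟩ eC)

  toTightPseudoWalk : ∀ {ℓ A B} → Walk ℓ A B → TightPseudoWalk H W (suc ℓ) A B
  toTightPseudoWalk {A = A} [ eA ] = (λ _ → A) , (λ _ _ → eA) , (λ { _ (s≤s ()) }) , refl , refl
  toTightPseudoWalk {ℓ = suc ℓ} {A = A} (eA ∷⟨ AB ⟩ w)
    with f , edges , adjacent , f0≡B , end ← toTightPseudoWalk w =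
    g , edges′ , adjacent′ , refl , end
    where
    g : ℕ → Subset n
    g zero    = A
    g (suc i) = f i
    edges′ : ∀ i → i < suc (suc ℓ) → Edge (g i)
    edges′ zero    _        = eA
    edges′ (suc i) (s≤s i<) = edges i i<
    adjacent′ : ∀ i → suc i < suc (suc ℓ) → Adjacent (g i) (g (suc i))
    adjacent′ zero    _        = subst (Adjacent A) (sym f0≡B) AB
    adjacent′ (suc i) (s≤s i<) = adjacent i i<

  common-subset⇒adjacent : ∀ {S A B} → S ⊆ A → S ⊆ B → ∣ S ∣ ≡ k ∸ 1 → Adjacent A B
  common-subset⇒adjacent S⊆A S⊆B ∣S∣≡k-1 =
    ≤-trans (≤-reflexive (sym ∣S∣≡k-1)) (p⊆q⇒∣p∣≤∣q∣ (r⊆p∧r⊆q⇒r⊆p∩q S⊆A S⊆B))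

  Approach : Subset n → Subset n → Set
  Approach A B = ∃₂ λ A′ B′ → Edge A′ × Edge B′ × Adjacent A A′ × Adjacent B′ B × ∣ A ∩ B ∣ < ∣ A′ ∩ B′ ∣

  module _ (approach : ∀ {A B} → Edge A → Edge B → ∣ A ∩ B ∣ < k ∸ 1 → Approach A B) where

    approach-or-stay : ∀ m {A B} → Edge A → Edge B → k ∸ 1 ≤ suc m + ∣ A ∩ B ∣ →
      ∃₂ λ A′ B′ → Edge A′ × Edge B′ × Adjacent A A′ × Adjacent B′ B × k ∸ 1 ≤ m + ∣ A′ ∩ B′ ∣
    approach-or-stay m {A} {B} eA eB close with ∣ A ∩ B ∣ <? k ∸ 1
    ... | no  near = A , B , eA , eB , adjacent-refl eA , adjacent-refl eB , ≤-trans (≮⇒≥ near) (m≤n+m _ m)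
    ... | yes far
      with A′ , B′ , eA′ , eB′ , AA′ , B′B , closer ← approach eA eB far =
      A′ , B′ , eA′ , eB′ , AA′ , B′B ,
      ≤-trans close (≤-trans (≤-reflexive (sym (+-suc m _))) (+-monoʳ-≤ m closer))

    walk : ∀ m {A B} → Edge A → Edge B → k ∸ 1 ≤ m + ∣ A ∩ B ∣ → Walk (1 + 2 * m) A B
    walk zero    eA eB near = eA ∷⟨ near ⟩ [ eB ]
    walk (suc m) {A} {B} eA eB close
      with A′ , B′ , eA′ , eB′ , AA′ , B′B , close′ ← approach-or-stay m eA eB close =
      subst (λ ℓ → Walk ℓ A B) (cong suc (sym (*-suc 2 m)))
            (eA ∷⟨ AA′ ⟩ (walk m eA′ eB′ close′ ∷ʳ⟨ B′B ⟩ eB))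

module Approaching where

  open import Defs
  open import Data.Bool using (T; true)
  open import Data.Bool.Properties using (T-≡)
  open import Data.Nat using (suc; _+_; _≤_; _<_)
  open import Data.Nat.Properties
  open import Data.List.Membership.Propositional using (_∈_)
  open import Data.Fin.Subset using (Subset; _∪_; _∩_; _⊆_; ∣_∣)
  open import Data.Fin.Subset.Properties using (_⊆?_; ⊆-trans; p⊆p∪q; p∩q⊆p; p∩q⊆q)
  open import Data.Rational using (1ℚ; _-_) renaming (_*_ to _*ℚ_; _<_ to _<ℚ_; _≤_ to _≤ℚ_)
  import Data.Rational as ℚ
  import Data.Rational.Properties as ℚ
  open import Data.Product using (∃-syntax; _×_; _,_; proj₁)
  open import Function.Bundles using (Equivalence)
  open import Relation.Binary.PropositionalEquality
  open RationalArithmetic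
  open FilterCounting using (∃-common)
  open SubsetProperties
  open SubsetsOfSize
  open Codegrees

  module _ {K n} (H : KGraph (suc K) n) (W : Subset n) where

    open Walks H W

    CommonExtension : Subset n → Subset n → Set
    CommonExtension S S′ =
      ∃[ D ] D ∈ subsetsOfSize n 1 × D ⊆ W × isEdge H (S ∪ D) ≡ true × isEdge H (S′ ∪ D) ≡ true

    approach-by-common-extension :
      ∀ {A B} → Edge A → Edge B → ∣ A ∩ B ∣ < K →
      (∀ {S S′} → S ⊆ A → ∣ S ∣ ≡ K → S′ ⊆ B → ∣ S′ ∣ ≡ K → CommonExtension S S′) →
      Approach A B
    approach-by-common-extension {A} {B} (eA , A⊆W) (eB , B⊆W) far common
      with S , A∩B⊆S , S⊆A , ∣S∣≡K ← ⊆-interpolate K (p∩q⊆p A B) (<⇒≤ far) (K≤∣edge∣ H eA)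
         | S′ , A∩B⊆S′ , S′⊆B , ∣S′∣≡K ← ⊆-interpolate K (p∩q⊆q A B) (<⇒≤ far) (K≤∣edge∣ H eB)
      with D , D∈ , D⊆W , SD , S′D ← common S⊆A ∣S∣≡K S′⊆B ∣S′∣≡K =
      S ∪ D , S′ ∪ D ,
      (eSD , p⊆r∧q⊆r⇒p∪q⊆r (⊆-trans S⊆A A⊆W) D⊆W) , (eS′D , p⊆r∧q⊆r⇒p∪q⊆r (⊆-trans S′⊆B B⊆W) D⊆W) ,
      common-subset⇒adjacent S⊆A (p⊆p∪q D) ∣S∣≡K , common-subset⇒adjacent (p⊆p∪q D) S′⊆B ∣S′∣≡K ,
      grows
      where
      ∣D∣≡1 : ∣ D ∣ ≡ 1
      ∣D∣≡1 = ∈-subsetsOfSize⁻ D∈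
      eSD : T (isEdge H (S ∪ D))
      eSD = Equivalence.from T-≡ SD
      eS′D : T (isEdge H (S′ ∪ D))
      eS′D = Equivalence.from T-≡ S′D
      grows : ∣ A ∩ B ∣ < ∣ (S ∪ D) ∩ (S′ ∪ D) ∣
      grows = begin
        suc ∣ A ∩ B ∣           ≡⟨ +-comm 1 ∣ A ∩ B ∣ ⟩
        ∣ A ∩ B ∣ + 1           ≡⟨ cong (∣ A ∩ B ∣ +_) ∣D∣≡1 ⟨
        ∣ A ∩ B ∣ + ∣ D ∣       ≤⟨ extension-grows A∩B⊆S A∩B⊆S′ S∩D≡0 ⟩
        ∣ (S ∪ D) ∩ (S′ ∪ D) ∣  ∎
        where
        open ≤-Reasoning
        S∩D≡0 : ∣ S ∩ D ∣ ≡ 0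
        S∩D≡0 = edge-split-disjoint H eSD (trans (cong₂ _+_ ∣S∣≡K ∣D∣≡1) (+-comm K 1))

  module _ {K n ε} {H : KGraph (suc K) n} (1≤K : 1 ≤ K) (dense : Dense (1ℚ - ε) ε H)
           {W : Subset n} (large : ℕtoℚ 2 *ℚ (ε *ℚ ℕtoℚ n) <ℚ ℕtoℚ ∣ W ∣) where

    open Walks H W

    high-codegree : ∀ {A S} → T (isEdge H A) → S ⊆ A → ∣ S ∣ ≡ K → (1ℚ - ε) *ℚ ℕtoℚ n ≤ℚ ℕtoℚ (degree H S)
    high-codegree = Dense⇒high-codegree H {1ℚ - ε} {ε} 1≤K dense

    crowded-neighbourhoods : ∀ {A B S S′} → T (isEdge H A) → S ⊆ A → ∣ S ∣ ≡ K →
                                           T (isEdge H B) → S′ ⊆ B → ∣ S′ ∣ ≡ K →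
                             n + n < ∣ W ∣ + (degree H S + degree H S′)
    crowded-neighbourhoods {S = S} {S′} eA S⊆A ∣S∣≡K eB S′⊆B ∣S′∣≡K = ℕtoℚ-cancel-< (begin-strict
      ℕtoℚ (n + n)
        ≡⟨ ℕtoℚ-homo-+ n n ⟩
      ℕtoℚ n ℚ.+ ℕtoℚ n
        <⟨ covering-bound ε (ℕtoℚ n) (ℕtoℚ ∣ W ∣) (ℕtoℚ (degree H S)) (ℕtoℚ (degree H S′)) large
             (high-codegree eA S⊆A ∣S∣≡K) (high-codegree eB S′⊆B ∣S′∣≡K) ⟩
      ℕtoℚ ∣ W ∣ ℚ.+ (ℕtoℚ (degree H S) ℚ.+ ℕtoℚ (degree H S′))
        ≡⟨ cong (ℕtoℚ ∣ W ∣ ℚ.+_) (ℕtoℚ-homo-+ (degree H S) (degree H S′)) ⟨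
      ℕtoℚ ∣ W ∣ ℚ.+ ℕtoℚ (degree H S + degree H S′)
        ≡⟨ ℕtoℚ-homo-+ ∣ W ∣ (degree H S + degree H S′) ⟨
      ℕtoℚ (∣ W ∣ + (degree H S + degree H S′)) ∎)
      where open ℚ.≤-Reasoning

    common-extension : ∀ {A B S S′} → T (isEdge H A) → S ⊆ A → ∣ S ∣ ≡ K →
                                       T (isEdge H B) → S′ ⊆ B → ∣ S′ ∣ ≡ K →
                       CommonExtension H W S S′
    common-extension {S = S} {S′} eA S⊆A ∣S∣≡K eB S′⊆B ∣S′∣≡K =
      ∃-common (_⊆? W) (extends? H S) (extends? H S′) (subsetsOfSize n 1)
        (subst₂ _<_ (sym (cong₂ _+_ (length-subsetsOfSize-1 n) (length-subsetsOfSize-1 n)))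
                    (cong₂ _+_ (sym (length-filter-⊆-subsetsOfSize-1 W))
                               (cong₂ _+_ (degree-codim1 H ∣S∣≡K) (degree-codim1 H ∣S′∣≡K)))
                    (crowded-neighbourhoods eA S⊆A ∣S∣≡K eB S′⊆B ∣S′∣≡K))

    approach : ∀ {A B} → Edge A → Edge B → ∣ A ∩ B ∣ < K → Approach A B
    approach {A} {B} eA eB far = approach-by-common-extension H W eA eB far
      (λ S⊆A ∣S∣≡K S′⊆B ∣S′∣≡K → common-extension (proj₁ eA) S⊆A ∣S∣≡K (proj₁ eB) S′⊆B ∣S′∣≡K)

open import Defs
open import Data.Nat using (ℕ; _≥_; _*_)
open import Data.Rational using (ℚ; 0ℚ; 1ℚ; _-_; _<_; _≤_) renaming (_*_ to _*ℚ_)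
open import Data.Product using (Σ; _×_)
open import Data.Fin.Subset using (Subset; ∣_∣)
open import Data.Nat using (suc; s≤s; z≤n)
open import Data.Nat.Properties using (*-suc; m≤m+n)
open import Data.Rational.Properties using (positive⁻¹)
open import Data.Product using (_,_)
open import Relation.Binary.PropositionalEquality using (subst; sym)
open Walks using (walk; toTightPseudoWalk)
open Approaching using (approach)

proposition3 :
    (k : ℕ) → k ≥ 2 →
    Σ ℚ λ ε₀ → (0ℚ < ε₀) ×
      ((ε : ℚ) → 0ℚ < ε → ε ≤ ε₀ →
        Σ ℕ λ n₀ → (n : ℕ) → n ≥ n₀ →
          (H : KGraph k n) → Dense (1ℚ - ε) ε H →
          (W : Subset n) → ℕtoℚ 2 *ℚ (ε *ℚ ℕtoℚ n) < ℕtoℚ ∣ W ∣ →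
          (e₁ e₂ : Subset n) → IsEdgeIn H W e₁ → IsEdgeIn H W e₂ →
          TightPseudoWalk H W (2 * k) e₁ e₂)
proposition3 (suc (suc K)) (s≤s (s≤s z≤n)) =
  1ℚ , positive⁻¹ 1ℚ , λ ε _ _ → 0 , λ n _ H dense W large e₁ e₂ e₁∈ e₂∈ →
    subst (λ ℓ → TightPseudoWalk H W ℓ e₁ e₂) (sym (*-suc 2 (suc K)))
      (toTightPseudoWalk H W
        (walk H W (approach {ε = ε} {H = H} (s≤s z≤n) dense large) (suc K) e₁∈ e₂∈ (m≤m+n (suc K) _)))
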